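{- Let $c_n$ denote the minimal Colless index over all rooted binary trees with $n$ leaves. Then $c_1=c_2=0$, and for all integers $n\ge 1$, $$c_{2n}=2c_n,\qquad c_{2n+1}=c_{n+1}+c_n+1.$$
   Context: A rooted binary tree with $n\ge2$ leaves is a rooted tree in which the root has degree 2 and every other internal vertex has degree 3 (each internal vertex has exactly two children); the single vertex is the rooted binary tree with one leaf. For a vertex $v$, $\kappa_T(v)$ is the number of leaves descending from $v$ ($1$ if $v$ is a leaf). For an internal vertex $v$ with children $v_1,v_2$, $bal_T(v)=|\kappa_T(v_1)-\kappa_T(v_2)|$, and the Colless index is $\mathcal{C}(T)=\sum_{v\text{ internal}} bal_T(v)$. -}

module Defs where

open import Data.Nat using (ℕ; zero; suc; _+_; _≤_; ∣_-_∣)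
open import Data.Product using (Σ; _×_)
open import Relation.Binary.PropositionalEquality using (_≡_)

-- Rooted binary trees: a single leaf, or a root with two subtrees.
-- (Child order is irrelevant for leaf counts / Colless index.)
data Tree : Set where
  leaf : Tree
  node : Tree → Tree → Tree

κ : Tree → ℕ
κ leaf       = 1
κ (node l r) = κ l + κ r

bal : Tree → Tree → ℕ
bal l r = ∣ κ l - κ r ∣

colless : Tree → ℕ
colless leaf       = 0
colless (node l r) = bal l r + colless l + colless r

IsMinColless : ℕ → ℕ → Set
IsMinColless n m =
  Σ Tree (λ T → κ T ≡ n × colless T ≡ m) ×
  ((T : Tree) → κ T ≡ n → m ≤ colless T)

-- The maximally balanced tree, whose root splits n leaves into ⌈n/2⌉ and ⌊n/2⌋, has
-- Colless index cmin n satisfying the two recurrences by construction. It is minimal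
-- because cmin (a + b) ≤ cmin a + cmin b + ∣ a - b ∣: applied at every internal vertex,
-- this bounds the Colless index of any tree from below by cmin of its leaf count. The
-- inequality is proved by strong induction on the smaller part b: halving a and b and
-- pairing the halves crosswise reduces it to two instances with smaller parts, except
-- for b = 1, where it says that adding a leaf to a tree t raises its Colless index by
-- less than κ t.

module Submission where

open import Defs
open import Data.Nat using (ℕ; zero; suc; _+_; _*_; _≤_; _<_; z≤n; s≤s; z<s; ∣_-_∣)
open import Data.Nat.Properties
open import Data.Nat.Induction using (<-wellFounded)
open import Data.Nat.Tactic.RingSolver using (solve; solve-∀)
open import Data.List using (_∷_; [])
open import Data.Product using (_×_; _,_)
open import Data.Sum using (inj₁; inj₂)
open import Induction.WellFounded using (Acc; acc)
open import Relation.Binary.PropositionalEquality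

∣1+m-n∣≤1+∣m-n∣ : ∀ m n → ∣ suc m - n ∣ ≤ suc ∣ m - n ∣
∣1+m-n∣≤1+∣m-n∣ zero    zero    = ≤-refl
∣1+m-n∣≤1+∣m-n∣ zero    (suc n) = ≤-trans (n≤1+n n) (n≤1+n (suc n))
∣1+m-n∣≤1+∣m-n∣ (suc m) zero    = ≤-refl
∣1+m-n∣≤1+∣m-n∣ (suc m) (suc n) = ∣1+m-n∣≤1+∣m-n∣ m n

∣1+n-n∣≡1 : ∀ n → ∣ suc n - n ∣ ≡ 1
∣1+n-n∣≡1 zero    = refl
∣1+n-n∣≡1 (suc n) = ∣1+n-n∣≡1 n

κ-positive : ∀ t → 0 < κ t
κ-positive leaf       = z<s
κ-positive (node l r) = ≤-trans (κ-positive l) (m≤m+n (κ l) (κ r))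

-- Adds one leaf. On a maximally balanced tree, whose left subtree is the larger
-- one, growing the right subtree and swapping keeps the tree maximally balanced.
grow : Tree → Tree
grow leaf       = node leaf leaf
grow (node l r) = node (grow r) l

κ-grow : ∀ t → κ (grow t) ≡ suc (κ t)
κ-grow leaf       = refl
κ-grow (node l r) = trans (cong (_+ κ l) (κ-grow r)) (cong suc (+-comm (κ r) (κ l)))

colless-grow : ∀ t → colless (grow t) + 1 ≤ colless t + κ t
colless-grow leaf       = ≤-refl
colless-grow (node l r) = begin
  ∣ κ (grow r) - κ l ∣ + colless (grow r) + colless l + 1
    ≡⟨ shift-one ∣ κ (grow r) - κ l ∣ (colless (grow r)) (colless l) ⟩
  ∣ κ (grow r) - κ l ∣ + (colless (grow r) + 1) + colless l
    ≤⟨ +-mono-≤ (+-mono-≤ balance-grows (colless-grow r)) ≤-refl ⟩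
  ∣ κ l - κ r ∣ + κ l + (colless r + κ r) + colless l
    ≡⟨ regroup ∣ κ l - κ r ∣ (κ l) (colless l) (colless r) (κ r) ⟩
  ∣ κ l - κ r ∣ + colless l + colless r + (κ l + κ r)
    ∎
  where
  open ≤-Reasoning
  shift-one : ∀ a b c → a + b + c + 1 ≡ a + (b + 1) + c
  shift-one = solve-∀
  regroup : ∀ a k c c′ k′ → a + k + (c′ + k′) + c ≡ a + c + c′ + (k + k′)
  regroup = solve-∀
  balance-grows : ∣ κ (grow r) - κ l ∣ ≤ ∣ κ l - κ r ∣ + κ l
  balance-grows = begin
    ∣ κ (grow r) - κ l ∣ ≡⟨ cong (∣_- κ l ∣) (κ-grow r) ⟩
    ∣ suc (κ r) - κ l ∣  ≤⟨ ∣1+m-n∣≤1+∣m-n∣ (κ r) (κ l) ⟩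
    suc ∣ κ r - κ l ∣    ≡⟨ cong suc (∣-∣-comm (κ r) (κ l)) ⟩
    suc ∣ κ l - κ r ∣    ≡⟨ +-comm 1 _ ⟩
    ∣ κ l - κ r ∣ + 1    ≤⟨ +-monoʳ-≤ _ (κ-positive l) ⟩
    ∣ κ l - κ r ∣ + κ l  ∎

-- balanced n is the maximally balanced tree with n leaves; balanced 0 is junk.
balanced : ℕ → Tree
balanced zero          = leaf
balanced (suc zero)    = leaf
balanced (suc (suc n)) = grow (balanced (suc n))

κ-balanced : ∀ n → κ (balanced (suc n)) ≡ suc n
κ-balanced zero    = refl
κ-balanced (suc n) = trans (κ-grow (balanced (suc n))) (cong suc (κ-balanced n))

balanced-even : ∀ m → 0 < m → balanced (m + m) ≡ node (balanced m) (balanced m)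
balanced-odd  : ∀ m → 0 < m → balanced (suc (m + m)) ≡ node (balanced (suc m)) (balanced m)

balanced-even (suc zero)    _ = refl
balanced-even (suc (suc m)) _ = begin
  grow (balanced (suc (m + suc (suc m))))   ≡⟨ cong (λ k → grow (balanced (suc k))) (+-suc m (suc m)) ⟩
  grow (balanced (suc (suc m + suc m)))     ≡⟨ cong grow (balanced-odd (suc m) z<s) ⟩
  node (balanced (suc (suc m))) (balanced (suc (suc m))) ∎
  where open ≡-Reasoning

balanced-odd (suc m) _ = cong grow (balanced-even (suc m) z<s)

cmin : ℕ → ℕ
cmin n = colless (balanced n)

cmin-even : ∀ m → cmin (m + m) ≡ cmin m + cmin m
cmin-even zero    = refl
cmin-even (suc m) = begin
  cmin (suc m + suc m)                   ≡⟨ cong colless (balanced-even (suc m) z<s) ⟩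
  ∣ κ B - κ B ∣ + colless B + colless B  ≡⟨ cong (λ x → x + colless B + colless B) (∣n-n∣≡0 (κ B)) ⟩
  cmin (suc m) + cmin (suc m)            ∎
  where
  open ≡-Reasoning
  B = balanced (suc m)

cmin-odd : ∀ m → 0 < m → cmin (suc (m + m)) ≡ cmin (suc m) + cmin m + 1
cmin-odd (suc m) _ = begin
  cmin (suc (suc m + suc m))               ≡⟨ cong colless (balanced-odd (suc m) z<s) ⟩
  ∣ κ B₊ - κ B ∣ + colless B₊ + colless B  ≡⟨ cong (λ x → x + colless B₊ + colless B) size-difference ⟩
  1 + cmin (suc (suc m)) + cmin (suc m)    ≡⟨ +-comm 1 _ ⟩
  cmin (suc (suc m)) + cmin (suc m) + 1    ∎
  where
  open ≡-Reasoning
  B₊ = balanced (suc (suc m))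
  B  = balanced (suc m)
  size-difference : ∣ κ B₊ - κ B ∣ ≡ 1
  size-difference = trans (cong₂ ∣_-_∣ (κ-balanced (suc m)) (κ-balanced m)) (∣1+n-n∣≡1 (suc m))

data Halves : ℕ → Set where
  even : ∀ m → Halves (m + m)
  odd  : ∀ m → Halves (suc (m + m))

halves : ∀ n → Halves n
halves zero    = even zero
halves (suc n) with halves n
... | even m = odd m
... | odd m  = subst Halves (cong suc (+-suc m m)) (even (suc m))

-- cmin (a + b) ≤ cmin a + cmin b + ∣ a - b ∣ for a = d + b; d is written on the left
-- so that the successors in d reduce out of every index.
CminSplit : ℕ → ℕ → Set
CminSplit b d = cmin (d + (b + b)) ≤ cmin (d + b) + cmin b + d

cminSplit-zeroˡ : ∀ d → CminSplit 0 d
cminSplit-zeroˡ d = ≤-trans (m≤m+n _ 0) (m≤m+n _ d)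

cminSplit-zeroʳ : ∀ b → CminSplit b 0
cminSplit-zeroʳ b = ≤-trans (≤-reflexive (cmin-even b)) (m≤m+n _ 0)

cminSplit-one : ∀ d → CminSplit 1 d
cminSplit-one d = +-cancelʳ-≤ 1 _ _ (begin
  cmin (d + 2) + 1                          ≡⟨ cong (λ k → cmin k + 1) (+-comm d 2) ⟩
  colless (grow (balanced (suc d))) + 1     ≤⟨ colless-grow (balanced (suc d)) ⟩
  cmin (suc d) + κ (balanced (suc d))       ≡⟨ cong₂ (λ k n → cmin k + n) (+-comm 1 d) (κ-balanced d) ⟩
  cmin (d + 1) + suc d                      ≡⟨ pad (cmin (d + 1)) d ⟩
  cmin (d + 1) + 0 + d + 1                  ∎)
  where
  open ≤-Reasoning
  pad : ∀ x d → x + suc d ≡ x + 0 + d + 1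
  pad = solve-∀

cminSplit-even-even : ∀ y e → CminSplit y e → CminSplit (y + y) (e + e)
cminSplit-even-even y e split = begin
  cmin (e + e + (y + y + (y + y)))
    ≡⟨ cong cmin outer ⟩
  cmin (e + (y + y) + (e + (y + y)))
    ≡⟨ cmin-even (e + (y + y)) ⟩
  cmin (e + (y + y)) + cmin (e + (y + y))
    ≤⟨ +-mono-≤ split split ⟩
  cmin (e + y) + cmin y + e + (cmin (e + y) + cmin y + e)
    ≡⟨ double-sum (cmin (e + y)) (cmin y) e ⟩
  cmin (e + y) + cmin (e + y) + (cmin y + cmin y) + (e + e)
    ≡⟨ cong₂ (λ u v → u + v + (e + e)) (sym (cmin-even (e + y))) (sym (cmin-even y)) ⟩
  cmin (e + y + (e + y)) + cmin (y + y) + (e + e)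
    ≡⟨ cong (λ k → cmin k + cmin (y + y) + (e + e)) inner ⟩
  cmin (e + e + (y + y)) + cmin (y + y) + (e + e)
    ∎
  where
  open ≤-Reasoning
  outer : e + e + (y + y + (y + y)) ≡ e + (y + y) + (e + (y + y))
  outer = solve (e ∷ y ∷ [])
  inner : e + y + (e + y) ≡ e + e + (y + y)
  inner = solve (e ∷ y ∷ [])
  double-sum : ∀ a b c → a + b + c + (a + b + c) ≡ a + a + (b + b) + (c + c)
  double-sum = solve-∀

cminSplit-even-odd : ∀ y e → 0 < y → CminSplit y (suc e) → CminSplit y e →
                     CminSplit (y + y) (suc (e + e))
cminSplit-even-odd y e y>0 split₁ split₀ = begin
  cmin (suc (e + e + (y + y + (y + y))))
    ≡⟨ cong (λ k → cmin (suc k)) outer ⟩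
  cmin (suc (m + m))
    ≡⟨ cmin-odd m m>0 ⟩
  cmin (suc m) + cmin m + 1
    ≤⟨ +-mono-≤ (+-mono-≤ split₁ split₀) ≤-refl ⟩
  cmin (suc (e + y)) + cmin y + suc e + (cmin (e + y) + cmin y + e) + 1
    ≡⟨ merge (cmin (suc (e + y))) (cmin (e + y)) (cmin y) e ⟩
  cmin (suc (e + y)) + cmin (e + y) + 1 + (cmin y + cmin y) + suc (e + e)
    ≡⟨ cong₂ (λ u v → u + v + suc (e + e)) (sym (cmin-odd (e + y) e+y>0)) (sym (cmin-even y)) ⟩
  cmin (suc (e + y + (e + y))) + cmin (y + y) + suc (e + e)
    ≡⟨ cong (λ k → cmin (suc k) + cmin (y + y) + suc (e + e)) inner ⟩
  cmin (suc (e + e + (y + y))) + cmin (y + y) + suc (e + e)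
    ∎
  where
  open ≤-Reasoning
  m = e + (y + y)
  e+y>0 : 0 < e + y
  e+y>0 = ≤-trans y>0 (m≤n+m y e)
  m>0 : 0 < m
  m>0 = ≤-trans e+y>0 (+-monoʳ-≤ e (m≤m+n y y))
  outer : e + e + (y + y + (y + y)) ≡ e + (y + y) + (e + (y + y))
  outer = solve (e ∷ y ∷ [])
  inner : e + y + (e + y) ≡ e + e + (y + y)
  inner = solve (e ∷ y ∷ [])
  merge : ∀ a b c e → a + c + suc e + (b + c + e) + 1 ≡ a + b + 1 + (c + c) + suc (e + e)
  merge = solve-∀

cminSplit-odd-even : ∀ y e → 0 < y → CminSplit y (suc (suc e)) → CminSplit (suc y) e →
                     CminSplit (suc (y + y)) (suc e + suc e)
cminSplit-odd-even y e y>0 split₂ split₁ = begin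
  cmin (suc e + suc e + (suc (y + y) + suc (y + y)))
    ≡⟨ cong cmin outer ⟩
  cmin (m + m)
    ≡⟨ cmin-even m ⟩
  cmin m + cmin m
    ≡⟨ cong (λ k → cmin m + cmin k) same ⟩
  cmin m + cmin (e + (suc y + suc y))
    ≤⟨ +-mono-≤ split₂ split₁ ⟩
  cmin (suc (suc e + y)) + cmin y + suc (suc e) + (cmin (e + suc y) + cmin (suc y) + e)
    ≡⟨ cong (λ k → cmin (suc (suc e + y)) + cmin y + suc (suc e) + (cmin k + cmin (suc y) + e)) (+-suc e y) ⟩
  cmin (suc (suc e + y)) + cmin y + suc (suc e) + (cmin (suc e + y) + cmin (suc y) + e)
    ≤⟨ m≤m+n _ 2 ⟩
  cmin (suc (suc e + y)) + cmin y + suc (suc e) + (cmin (suc e + y) + cmin (suc y) + e) + 2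
    ≡⟨ merge (cmin (suc (suc e + y))) (cmin (suc e + y)) (cmin y) (cmin (suc y)) e ⟩
  cmin (suc (suc e + y)) + cmin (suc e + y) + 1 + (cmin (suc y) + cmin y + 1) + (suc e + suc e)
    ≡⟨ cong₂ (λ u v → u + v + (suc e + suc e)) (sym (cmin-odd (suc e + y) z<s)) (sym (cmin-odd y y>0)) ⟩
  cmin (suc (suc e + y + (suc e + y))) + cmin (suc (y + y)) + (suc e + suc e)
    ≡⟨ cong (λ k → cmin k + cmin (suc (y + y)) + (suc e + suc e)) inner ⟩
  cmin (suc e + suc e + suc (y + y)) + cmin (suc (y + y)) + (suc e + suc e)
    ∎
  where
  open ≤-Reasoning
  m = suc (suc e) + (y + y)
  outer : suc e + suc e + (suc (y + y) + suc (y + y)) ≡ suc (suc e) + (y + y) + (suc (suc e) + (y + y))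
  outer = solve (e ∷ y ∷ [])
  same : suc (suc e) + (y + y) ≡ e + (suc y + suc y)
  same = solve (e ∷ y ∷ [])
  inner : suc (suc e + y + (suc e + y)) ≡ suc e + suc e + suc (y + y)
  inner = solve (e ∷ y ∷ [])
  merge : ∀ a b c c′ e → a + c + suc (suc e) + (b + c′ + e) + 2 ≡ a + b + 1 + (c′ + c + 1) + (suc e + suc e)
  merge = solve-∀

cminSplit-odd-odd : ∀ y e → 0 < y → CminSplit y (suc e) → CminSplit (suc y) e →
                    CminSplit (suc (y + y)) (suc (e + e))
cminSplit-odd-odd y e y>0 split₁ split₂ = begin
  cmin (suc (e + e) + (suc (y + y) + suc (y + y)))
    ≡⟨ cong cmin outer ⟩
  cmin (suc (m + m))
    ≡⟨ cmin-odd m z<s ⟩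
  cmin (suc m) + cmin m + 1
    ≡⟨ cong (λ k → cmin k + cmin m + 1) same ⟩
  cmin (e + (suc y + suc y)) + cmin m + 1
    ≤⟨ +-mono-≤ (+-mono-≤ split₂ split₁) ≤-refl ⟩
  cmin (e + suc y) + cmin (suc y) + e + (cmin (suc e + y) + cmin y + suc e) + 1
    ≡⟨ cong (λ k → cmin k + cmin (suc y) + e + (cmin (suc e + y) + cmin y + suc e) + 1) (+-suc e y) ⟩
  cmin (suc e + y) + cmin (suc y) + e + (cmin (suc e + y) + cmin y + suc e) + 1
    ≡⟨ merge (cmin (suc e + y)) (cmin (suc y)) (cmin y) e ⟩
  cmin (suc e + y) + cmin (suc e + y) + (cmin (suc y) + cmin y + 1) + suc (e + e)
    ≡⟨ cong₂ (λ u v → u + v + suc (e + e)) (sym (cmin-even (suc e + y))) (sym (cmin-odd y y>0)) ⟩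
  cmin (suc e + y + (suc e + y)) + cmin (suc (y + y)) + suc (e + e)
    ≡⟨ cong (λ k → cmin k + cmin (suc (y + y)) + suc (e + e)) inner ⟩
  cmin (suc (e + e) + suc (y + y)) + cmin (suc (y + y)) + suc (e + e)
    ∎
  where
  open ≤-Reasoning
  m = suc e + (y + y)
  outer : suc (e + e) + (suc (y + y) + suc (y + y)) ≡ suc (suc e + (y + y) + (suc e + (y + y)))
  outer = solve (e ∷ y ∷ [])
  same : suc (suc e + (y + y)) ≡ e + (suc y + suc y)
  same = solve (e ∷ y ∷ [])
  inner : suc e + y + (suc e + y) ≡ suc (e + e) + suc (y + y)
  inner = solve (e ∷ y ∷ [])
  merge : ∀ a c c′ e → a + c + e + (a + c′ + suc e) + 1 ≡ a + a + (c + c′ + 1) + suc (e + e)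
  merge = solve-∀

cminSplit : ∀ b d → CminSplit b d
cminSplit b = go b (<-wellFounded b)
  where
  y<2y : ∀ y → suc y < suc y + suc y
  y<2y y = m<m+n (suc y) z<s
  y<2y+1 : ∀ y → suc y < suc (suc y + suc y)
  y<2y+1 y = s≤s (s≤s (m≤m+n y (suc y)))
  y+1<2y+1 : ∀ y → suc (suc y) < suc (suc y + suc y)
  y+1<2y+1 y = s≤s (s≤s (m≤n+m (suc y) y))

  go : ∀ b → Acc _<_ b → ∀ d → CminSplit b d
  go b (acc rec) d with halves b | halves d
  ... | even zero    | _            = cminSplit-zeroˡ d
  ... | odd zero     | _            = cminSplit-one d
  ... | even (suc y) | even e       =
    cminSplit-even-even (suc y) e (go (suc y) (rec (y<2y y)) e)
  ... | even (suc y) | odd e        =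
    cminSplit-even-odd (suc y) e z<s (go (suc y) (rec (y<2y y)) (suc e)) (go (suc y) (rec (y<2y y)) e)
  ... | odd (suc y)  | even zero    = cminSplit-zeroʳ (suc (suc y + suc y))
  ... | odd (suc y)  | even (suc e) =
    cminSplit-odd-even (suc y) e z<s
      (go (suc y) (rec (y<2y+1 y)) (suc (suc e))) (go (suc (suc y)) (rec (y+1<2y+1 y)) e)
  ... | odd (suc y)  | odd e        =
    cminSplit-odd-odd (suc y) e z<s
      (go (suc y) (rec (y<2y+1 y)) (suc e)) (go (suc (suc y)) (rec (y+1<2y+1 y)) e)

cmin-+-≤′ : ∀ a b → b ≤ a → cmin (a + b) ≤ cmin a + cmin b + ∣ a - b ∣
cmin-+-≤′ a b b≤a with m≤n⇒∃[o]m+o≡n b≤a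
... | d , refl = subst₂ _≤_ (cong cmin index)
                            (cong₂ _+_ (cong (λ k → cmin k + cmin b) (+-comm d b)) distance)
                            (cminSplit b d)
  where
  index : d + (b + b) ≡ b + d + b
  index = solve (d ∷ b ∷ [])
  distance : d ≡ ∣ b + d - b ∣
  distance = sym (trans (∣-∣-comm (b + d) b) (∣m-m+n∣≡n b d))

cmin-+-≤ : ∀ a b → cmin (a + b) ≤ cmin a + cmin b + ∣ a - b ∣
cmin-+-≤ a b with ≤-total b a
... | inj₁ b≤a = cmin-+-≤′ a b b≤a
... | inj₂ a≤b = subst₂ _≤_ (cong cmin (+-comm b a))
                             (cong₂ _+_ (+-comm (cmin b) (cmin a)) (∣-∣-comm b a))
                             (cmin-+-≤′ b a a≤b)

cmin-κ-≤-colless : ∀ T → cmin (κ T) ≤ colless T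
cmin-κ-≤-colless leaf       = z≤n
cmin-κ-≤-colless (node l r) = begin
  cmin (κ l + κ r)                    ≤⟨ cmin-+-≤ (κ l) (κ r) ⟩
  cmin (κ l) + cmin (κ r) + bal l r   ≤⟨ +-monoˡ-≤ (bal l r) (+-mono-≤ (cmin-κ-≤-colless l) (cmin-κ-≤-colless r)) ⟩
  colless l + colless r + bal l r     ≡⟨ trans (+-comm _ (bal l r)) (sym (+-assoc (bal l r) _ _)) ⟩
  bal l r + colless l + colless r     ∎
  where open ≤-Reasoning

isMinColless-cmin : ∀ n → 0 < n → IsMinColless n (cmin n)
isMinColless-cmin (suc n) _ =
  (balanced (suc n) , κ-balanced n , refl) ,
  λ T κT≡n → subst (λ k → cmin k ≤ colless T) κT≡n (cmin-κ-≤-colless T)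

isMinColless-unique : ∀ {n a b} → IsMinColless n a → IsMinColless n b → a ≡ b
isMinColless-unique ((S , κS≡n , S≡a) , a-min) ((T , κT≡n , T≡b) , b-min) =
  ≤-antisym (subst (_ ≤_) T≡b (a-min T κT≡n)) (subst (_ ≤_) S≡a (b-min S κS≡n))

theorem1 : IsMinColless 1 0 × IsMinColless 2 0 ×
    ((n a b : ℕ) → 1 ≤ n → IsMinColless n a → IsMinColless (n + 1) b →
      IsMinColless (2 * n) (2 * a) × IsMinColless (2 * n + 1) (b + a + 1))
theorem1 = isMinColless-cmin 1 z<s , isMinColless-cmin 2 z<s , recurrences
  where
  recurrences : (n a b : ℕ) → 1 ≤ n → IsMinColless n a → IsMinColless (n + 1) b →
    IsMinColless (2 * n) (2 * a) × IsMinColless (2 * n + 1) (b + a + 1)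
  recurrences n a b n>0 min-a min-b
    with isMinColless-unique (isMinColless-cmin n n>0) min-a
       | isMinColless-unique (isMinColless-cmin (n + 1) (m≤n⇒m≤n+o 1 n>0)) min-b
  ... | refl | refl =
    subst₂ IsMinColless (sym (two-mul n)) (trans (cmin-even n) (sym (two-mul (cmin n))))
      (isMinColless-cmin (n + n) (m≤n⇒m≤n+o n n>0)) ,
    subst₂ IsMinColless odd-index
      (trans (cmin-odd n n>0) (cong (λ k → cmin k + cmin n + 1) (+-comm 1 n)))
      (isMinColless-cmin (suc (n + n)) z<s)
    where
    two-mul : ∀ m → 2 * m ≡ m + m
    two-mul m = cong (m +_) (+-identityʳ m)
    odd-index : suc (n + n) ≡ 2 * n + 1
    odd-index = solve (n ∷ [])
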